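{- Let $G$ be a graph and let $B_{2^+}$ be the set of special branching points of $G$ that have at least two legs attached. Then $DP(G)\ge |B_{2^+}|$.
   Context: All graphs are finite, simple and undirected, and $d(u,v)$ denotes the distance in the graph. A vertex $w$ dominates all vertices of its closed neighbourhood $N[w]$. A vertex $l$ separates vertices $u,v$ if $d(u,l)\neq d(v,l)$. Given $W\subseteq V(G)$ (watchers) and $L\subseteq V(G)$ (listeners), a vertex $u$ is distinguished by $(W,L)$ if either $u$ is dominated by a vertex of $W$, or for every other vertex $v$, either $v$ is dominated by a vertex of $W$ or some vertex of $L$ separates $u$ and $v$. $(W,L)$ is a detection pair of $G$ if every vertex is distinguished; its size is $|W|+|L|$, and $DP(G)$ is the minimum size of a detection pair. A leaf is a vertex of degree $1$; a branching point is a vertex of degree at least $3$. A branching point $v$ is special if there is a path starting at $v$ and ending at a vertex of degree $1$ whose inner vertices all have degree $2$; for each such path $P$, the path $P-v$ is called a leg attached to $v$ (the vertex $v$ does not belong to the leg). -}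

module Defs where

open import Data.Nat using (ℕ; zero; suc)
open import Data.Bool using (Bool; true; false; _∧_; _∨_; if_then_else_)
open import Data.Fin using (Fin; _≟_)
open import Data.Fin.Subset using (Subset; _∈_)
open import Data.List using (List; []; _∷_; _++_; [_]; length; filterᵇ; allFin)
open import Data.Bool.ListAction using (any)
open import Data.List.Relation.Unary.All using (All)
open import Data.List.Relation.Unary.Linked using (Linked)
open import Data.List.Relation.Unary.Unique.Propositional using (Unique)
open import Data.Maybe using (Maybe; just; nothing)
open import Data.Product using (Σ; _×_; _,_; ∃)
open import Data.Sum using (_⊎_)
open import Relation.Nullary using (¬_; does)
open import Relation.Binary.PropositionalEquality using (_≡_; _≢_)

record Graph : Set where
  field
    n      : ℕ
    adj    : Fin n → Fin n → Bool
    sym    : ∀ u v → adj u v ≡ adj v u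
    irrefl : ∀ u → adj u u ≡ false

module _ (G : Graph) where
  open Graph G

  Adj : Fin n → Fin n → Set
  Adj u v = adj u v ≡ true

  deg : Fin n → ℕ
  deg v = length (filterᵇ (adj v) (allFin n))

  reach : ℕ → Fin n → Fin n → Bool
  reach zero    u v = does (u ≟ v)
  reach (suc k) u v = reach k u v ∨ any (λ w → adj u w ∧ reach k w v) (allFin n)

  distSearch : Fin n → Fin n → ℕ → ℕ → Maybe ℕ
  distSearch u v k zero     = nothing
  distSearch u v k (suc f)  = if reach k u v then just k else distSearch u v (suc k) f

  -- graph distance; nothing = infinite distance (different components).
  -- Shortest paths have length < n, so searching k = 0, ..., n-1 suffices.
  dist : Fin n → Fin n → Maybe ℕ
  dist u v = distSearch u v 0 n

  Dominates : Fin n → Fin n → Set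
  Dominates w u = (w ≡ u) ⊎ Adj w u

  DominatedBy : Subset n → Fin n → Set
  DominatedBy W u = Σ (Fin n) λ w → w ∈ W × Dominates w u

  Separates : Fin n → Fin n → Fin n → Set
  Separates l u v = dist u l ≢ dist v l

  Distinguished : Subset n → Subset n → Fin n → Set
  Distinguished W L u =
    DominatedBy W u ⊎
    (∀ v → v ≢ u → DominatedBy W v ⊎ (Σ (Fin n) λ l → l ∈ L × Separates l u v))

  IsDetectionPair : Subset n → Subset n → Set
  IsDetectionPair W L = ∀ u → Distinguished W L u

  IsPath : List (Fin n) → Set
  IsPath ps = Linked Adj ps × Unique ps

  -- A leg attached to v, given as the vertex list  qs ++ [ x ]  (v excluded):
  -- v ∷ qs ++ [ x ] is a path, x has degree 1, inner vertices qs have degree 2.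
  IsLeg : Fin n → List (Fin n) → Fin n → Set
  IsLeg v qs x = IsPath (v ∷ qs ++ [ x ]) × All (λ q → deg q ≡ 2) qs × deg x ≡ 1

  BranchingPoint : Fin n → Set
  BranchingPoint v = 3 Data.Nat.≤ deg v

  SpecialBranchingPoint : Fin n → Set
  SpecialBranchingPoint v =
    BranchingPoint v × (Σ (List (Fin n)) λ qs → Σ (Fin n) λ x → IsLeg v qs x)

  InB2+ : Fin n → Set
  InB2+ v = SpecialBranchingPoint v ×
    (Σ (List (Fin n)) λ qs → Σ (Fin n) λ x → Σ (List (Fin n)) λ qs' → Σ (Fin n) λ x' →
      IsLeg v qs x × IsLeg v qs' x' × ¬ ((qs ++ [ x ]) ≡ (qs' ++ [ x' ])))

module Submission where

open import Defs
open import Data.Nat using (_+_; _≤_)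
open import Data.Fin.Subset using (Subset; _∈_; ∣_∣)

open import Data.Bool using (true; false; _∨_; T?)
open import Data.Bool.Properties using (T-≡; T-∧; ∨-zeroʳ; ⇔→≡)
open import Data.Fin using (Fin; _≟_; zero; suc)
open import Data.Fin.Properties using (suc-injective)
open import Data.Fin.Subset using (inside; outside)
open import Data.List using (List; []; _∷_; _++_; [_]; length; map; allFin)
open import Data.List.Properties using (length-++; length-map)
open import Data.List.Membership.Propositional using (lose)
  renaming (_∈_ to _∈ₗ_; _∉_ to _∉ₗ_)
open import Data.List.Membership.Propositional.Properties
  using (∈-filter⁺; ∈-allFin; ∈-++⁺ˡ; ∈-++⁺ʳ; ∈-map⁺; ∈-map⁻)
open import Data.List.Relation.Unary.All using (All; []; _∷_; lookup; tabulate)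
open import Data.List.Relation.Unary.AllPairs using ([]; _∷_)
open import Data.List.Relation.Unary.Any using (here; there; satisfied)
open import Data.List.Relation.Unary.Any.Properties using (any⁺; any⁻)
open import Data.List.Relation.Unary.Linked using (_∷_)
open import Data.List.Relation.Unary.Unique.Propositional using (Unique)
open import Data.List.Relation.Unary.Unique.Propositional.Properties
  using () renaming (map⁺ to Unique-map⁺)
open import Data.Nat using (zero; suc; z≤n; s≤s)
open import Data.Nat.Properties using (≤-trans; module ≤-Reasoning)
open import Data.Product using (∃-syntax; _×_; _,_)
open import Data.Sum using (_⊎_; inj₁; inj₂; map₂)
open import Data.Empty using (⊥-elim)
open import Data.Vec using ([]; _∷_; here; there)
open import Function using (_∘_; mk⇔)
open import Function.Bundles using (module Equivalence)
open Equivalence using (to; from)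
open import Relation.Nullary using (yes; no)
open import Relation.Binary.PropositionalEquality
  using (_≡_; _≢_; refl; sym; trans; cong; cong₂; subst)

-- Let S_v consist of a special branching point v and the vertices of its legs.
-- If v has two legs, S_v contains a watcher or a listener: otherwise the first
-- vertices of the two legs are not dominated, and every vertex outside S_v
-- sees both of them through v, at the same distance.  Legs contain no
-- branching point and legs attached to different vertices are disjoint, so the
-- sets S_v are pairwise disjoint and |B| ≤ |W| + |L| by pigeonhole.

module _ {A B : Set} where

  private
    remove : ∀ {b : B} {ys} → b ∈ₗ ys → ∃[ ys′ ]
      length ys ≡ suc (length ys′) × (∀ {c} → c ∈ₗ ys → c ≢ b → c ∈ₗ ys′)
    remove {ys = _ ∷ ys} (here refl) = ys , refl , λ where
      (here refl) c≢b → ⊥-elim (c≢b refl)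
      (there c∈ys) _  → c∈ys
    remove {ys = y ∷ _} (there b∈ys) with remove b∈ys
    ... | ys′ , len , keep = y ∷ ys′ , cong suc len , λ where
      (here refl) _    → here refl
      (there c∈ys) c≢b → there (keep c∈ys c≢b)

  length-≤-by-matching : (R : A → B → Set) → (∀ {a a′ b} → R a b → R a′ b → a ≡ a′) →
    ∀ {xs} ys → Unique xs → (∀ {a} → a ∈ₗ xs → ∃[ b ] R a b × b ∈ₗ ys) →
    length xs ≤ length ys
  length-≤-by-matching R R-inj ys [] match = z≤n
  length-≤-by-matching R R-inj {_ ∷ xs} ys (x∉xs ∷ xs!) match with match (here refl)
  ... | b , xRb , b∈ys with remove b∈ys
  ...   | ys′ , len , keep rewrite len =
    s≤s (length-≤-by-matching R R-inj ys′ xs! match′)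
    where
    match′ : ∀ {a} → a ∈ₗ xs → ∃[ c ] R a c × c ∈ₗ ys′
    match′ a∈xs with match (there a∈xs)
    ... | c , aRc , c∈ys = c , aRc , keep c∈ys λ where
      refl → lookup x∉xs a∈xs (R-inj xRb aRc)

elements : ∀ {n} → Subset n → List (Fin n)
elements []            = []
elements (inside ∷ p)  = zero ∷ map suc (elements p)
elements (outside ∷ p) = map suc (elements p)

length-elements : ∀ {n} (p : Subset n) → length (elements p) ≡ ∣ p ∣
length-elements []            = refl
length-elements (inside ∷ p)  = cong suc (trans (length-map suc (elements p)) (length-elements p))
length-elements (outside ∷ p) = trans (length-map suc (elements p)) (length-elements p)

∈-elements⁺ : ∀ {n} {x : Fin n} (p : Subset n) → x ∈ p → x ∈ₗ elements p
∈-elements⁺ (inside ∷ p)  here      = here refl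
∈-elements⁺ (inside ∷ p)  (there m) = there (∈-map⁺ suc (∈-elements⁺ p m))
∈-elements⁺ (outside ∷ p) (there m) = ∈-map⁺ suc (∈-elements⁺ p m)

∈-elements⁻ : ∀ {n} {x : Fin n} (p : Subset n) → x ∈ₗ elements p → x ∈ p
∈-elements⁻ (inside ∷ p) (here refl) = here
∈-elements⁻ (inside ∷ p) (there m) with ∈-map⁻ suc m
... | _ , m′ , refl = there (∈-elements⁻ p m′)
∈-elements⁻ (outside ∷ p) m with ∈-map⁻ suc m
... | _ , m′ , refl = there (∈-elements⁻ p m′)

elements-unique : ∀ {n} (p : Subset n) → Unique (elements p)
elements-unique []            = []
elements-unique (inside ∷ p)  =
  tabulate zero∉ ∷ Unique-map⁺ suc-injective (elements-unique p)
  where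
  zero∉ : ∀ {y} → y ∈ₗ map suc (elements p) → zero ≢ y
  zero∉ m with ∈-map⁻ suc m
  ... | _ , _ , refl = λ ()
elements-unique (outside ∷ p) = Unique-map⁺ suc-injective (elements-unique p)

∣B∣≤∣W∣+∣L∣-by-matching : ∀ {n} (R : Fin n → Fin n → Set) →
  (∀ {a a′ b} → R a b → R a′ b → a ≡ a′) → (B W L : Subset n) →
  (∀ {b} → b ∈ B → ∃[ w ] R b w × (w ∈ W ⊎ w ∈ L)) → ∣ B ∣ ≤ ∣ W ∣ + ∣ L ∣
∣B∣≤∣W∣+∣L∣-by-matching R R-inj B W L match = begin
  ∣ B ∣                                   ≡⟨ sym (length-elements B) ⟩
  length (elements B)                     ≤⟨ length-≤-by-matching R R-inj (elements W ++ elements L)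
                                               (elements-unique B) match′ ⟩
  length (elements W ++ elements L)       ≡⟨ length-++ (elements W) ⟩
  length (elements W) + length (elements L) ≡⟨ cong₂ _+_ (length-elements W) (length-elements L) ⟩
  ∣ W ∣ + ∣ L ∣                           ∎
  where
  open ≤-Reasoning
  match′ : ∀ {b} → b ∈ₗ elements B → ∃[ w ] R b w × w ∈ₗ elements W ++ elements L
  match′ b∈B with match (∈-elements⁻ B b∈B)
  ... | w , bRw , inj₁ w∈W = w , bRw , ∈-++⁺ˡ (∈-elements⁺ W w∈W)
  ... | w , bRw , inj₂ w∈L = w , bRw , ∈-++⁺ʳ (elements W) (∈-elements⁺ L w∈L)

module _ (G : Graph) where
  open Graph G using (n; adj)
  open import Data.List.Membership.DecPropositional (_≟_ {n}) using () renaming (_∈?_ to _∈ₗ?_)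

  private
    _~_ : Fin n → Fin n → Set
    _~_ = Adj G

  ~-sym : ∀ {u w} → u ~ w → w ~ u
  ~-sym {u} {w} u~w = trans (Graph.sym G w u) u~w

  distinct-neighbours⇒length≤deg : ∀ {u ys} → Unique ys → All (u ~_) ys → length ys ≤ deg G u
  distinct-neighbours⇒length≤deg {u} ys! u~ys =
    length-≤-by-matching _≡_ (λ { refl refl → refl }) _ ys! λ y∈ys →
      _ , refl , ∈-filter⁺ (λ y → T? (adj u y)) (∈-allFin _)
                   (from T-≡ (lookup u~ys y∈ys))

  two-neighbours⇒2≤deg : ∀ {u a b} → u ~ a → u ~ b → a ≢ b → 2 ≤ deg G u
  two-neighbours⇒2≤deg u~a u~b a≢b =
    distinct-neighbours⇒length≤deg ((a≢b ∷ []) ∷ [] ∷ []) (u~a ∷ u~b ∷ [])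

  three-neighbours⇒3≤deg : ∀ {u a b c} → u ~ a → u ~ b → u ~ c →
    a ≢ b → a ≢ c → b ≢ c → 3 ≤ deg G u
  three-neighbours⇒3≤deg u~a u~b u~c a≢b a≢c b≢c =
    distinct-neighbours⇒length≤deg ((a≢b ∷ a≢c ∷ []) ∷ (b≢c ∷ []) ∷ [] ∷ []) (u~a ∷ u~b ∷ u~c ∷ [])

  data Leg (v : Fin n) : List (Fin n) → Set where
    leaf : ∀ {x} → v ~ x → deg G x ≡ 1 → Leg v [ x ]
    link : ∀ {y z zs} → v ~ y → deg G y ≡ 2 → v ≢ z → Leg y (z ∷ zs) → Leg v (y ∷ z ∷ zs)

  isLeg⇒Leg : ∀ {v} qs {x} → IsLeg G v qs x → Leg v (qs ++ [ x ])
  isLeg⇒Leg [] ((v~x ∷ _ , _) , _ , deg-x) = leaf v~x deg-x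
  isLeg⇒Leg (q ∷ []) ((v~q ∷ path , (_ ∷ v≢x ∷ []) ∷ uniq) , deg-q ∷ [] , deg-x) =
    link v~q deg-q v≢x (isLeg⇒Leg [] ((path , uniq) , [] , deg-x))
  isLeg⇒Leg (q ∷ q′ ∷ qs) ((v~q ∷ path , (_ ∷ v≢q′ ∷ _) ∷ uniq) , deg-q ∷ degs , deg-x) =
    link v~q deg-q v≢q′ (isLeg⇒Leg (q′ ∷ qs) ((path , uniq) , degs , deg-x))

  Leg-head : ∀ {v y ys} → Leg v (y ∷ ys) → v ~ y
  Leg-head (leaf v~y _)       = v~y
  Leg-head (link v~y _ _ _)   = v~y

  Leg-deg≤2 : ∀ {v ys u} → Leg v ys → u ∈ₗ ys → deg G u ≤ 2
  Leg-deg≤2 (leaf _ deg≡1)     (here refl) rewrite deg≡1 = s≤s z≤n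
  Leg-deg≤2 (link _ deg≡2 _ _) (here refl) rewrite deg≡2 = s≤s (s≤s z≤n)
  Leg-deg≤2 (link _ _ _ leg)   (there u∈ys) = Leg-deg≤2 leg u∈ys

  branching∉Leg : ∀ {v ys u} → Leg v ys → BranchingPoint G u → u ∉ₗ ys
  branching∉Leg leg 3≤deg u∈ys with ≤-trans 3≤deg (Leg-deg≤2 leg u∈ys)
  ... | s≤s (s≤s ())

  ExitsOnlyThrough : List (Fin n) → Fin n → Set
  ExitsOnlyThrough X v = ∀ {u w} → u ∈ₗ X → u ~ w → w ∈ₗ X ⊎ w ≡ v

  Leg-closed : ∀ {v ys} → Leg v ys → ExitsOnlyThrough ys v
  Leg-closed {v} (leaf v~x deg≡1) {w = w} (here refl) x~w with w ≟ v
  ... | yes w≡v = inj₂ w≡v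
  ... | no w≢v with subst (2 ≤_) deg≡1 (two-neighbours⇒2≤deg (~-sym v~x) x~w (w≢v ∘ sym))
  ...   | s≤s ()
  Leg-closed {v} leg@(link {z = z} v~y _ v≢z rest) {w = w} (here refl) y~w with w ≟ v | w ≟ z
  ... | yes w≡v | _        = inj₂ w≡v
  ... | no _    | yes refl = inj₁ (there (here refl))
  ... | no w≢v  | no w≢z   = ⊥-elim (branching∉Leg leg
    (three-neighbours⇒3≤deg (~-sym v~y) (Leg-head rest) y~w v≢z (w≢v ∘ sym) (w≢z ∘ sym)) (here refl))
  Leg-closed (link _ _ _ leg) (there u∈ys) u~w with Leg-closed leg u∈ys u~w
  ... | inj₁ w∈ys  = inj₁ (there w∈ys)
  ... | inj₂ refl  = inj₁ (here refl)

  Leg-determined-by-head : ∀ {v y ys ys′} → Leg v (y ∷ ys) → Leg v (y ∷ ys′) → ys ≡ ys′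
  Leg-determined-by-head (leaf _ _) (leaf _ _) = refl
  Leg-determined-by-head (leaf _ deg≡1) (link _ deg≡2 _ _) with trans (sym deg≡1) deg≡2
  ... | ()
  Leg-determined-by-head (link _ deg≡2 _ _) (leaf _ deg≡1) with trans (sym deg≡1) deg≡2
  ... | ()
  Leg-determined-by-head leg@(link {z = z} v~y _ v≢z rest) (link {z = z′} _ _ v≢z′ rest′) with z ≟ z′
  ... | yes refl = cong (z ∷_) (Leg-determined-by-head rest rest′)
  ... | no z≢z′  = ⊥-elim (branching∉Leg leg
    (three-neighbours⇒3≤deg (~-sym v~y) (Leg-head rest) (Leg-head rest′) v≢z v≢z′ z≢z′) (here refl))

  entering-Leg⇒base : ∀ {v ys p c} → Leg v ys → p ∉ₗ ys → c ∈ₗ ys → p ~ c → p ≡ v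
  entering-Leg⇒base leg p∉ys c∈ys p~c with Leg-closed leg c∈ys (~-sym p~c)
  ... | inj₁ p∈ys = ⊥-elim (p∉ys p∈ys)
  ... | inj₂ p≡v  = p≡v

  -- The leg at p enters ys from outside, hence through v; since the inner
  -- vertices of the leg at p have degree 2, the entry happens right after p.
  Legs-meet⇒same-base : ∀ {v ys p cs u} → BranchingPoint G v → Leg v ys → Leg p cs →
    p ∉ₗ ys → u ∈ₗ cs → u ∈ₗ ys → p ≡ v
  Legs-meet⇒same-base bv leg (leaf p~c _) p∉ys (here refl) c∈ys = entering-Leg⇒base leg p∉ys c∈ys p~c
  Legs-meet⇒same-base {ys = ys} bv leg legᵖ@(link {y = c} p~c _ _ rest) p∉ys u∈cs u∈ys with c ∈ₗ? ys
  ... | yes c∈ys = entering-Leg⇒base leg p∉ys c∈ys p~c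
  ... | no c∉ys with u∈cs
  ...   | here refl    = ⊥-elim (c∉ys u∈ys)
  ...   | there u∈rest with Legs-meet⇒same-base bv leg rest c∉ys u∈rest u∈ys
  ...     | refl = ⊥-elim (branching∉Leg legᵖ bv (here refl))

  InStar : Fin n → Fin n → Set
  InStar v w = BranchingPoint G v × (w ≡ v ⊎ ∃[ ys ] Leg v ys × w ∈ₗ ys)

  InStar-injective : ∀ {v v′ w} → InStar v w → InStar v′ w → v ≡ v′
  InStar-injective (_  , inj₁ refl) (_   , inj₁ refl) = refl
  InStar-injective (bv , inj₁ refl) (_   , inj₂ (_ , leg′ , v∈ys′)) = ⊥-elim (branching∉Leg leg′ bv v∈ys′)
  InStar-injective (_  , inj₂ (_ , leg , v′∈ys)) (bv′ , inj₁ refl) = ⊥-elim (branching∉Leg leg bv′ v′∈ys)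
  InStar-injective (bv , inj₂ (_ , leg , w∈ys)) (bv′ , inj₂ (_ , leg′ , w∈ys′)) =
    sym (Legs-meet⇒same-base bv leg leg′ (branching∉Leg leg bv′) w∈ys′ w∈ys)

  reach-zero⁻ : ∀ {u l} → reach G 0 u l ≡ true → u ≡ l
  reach-zero⁻ {u} {l} r with u ≟ l
  reach-zero⁻ _  | yes u≡l = u≡l
  reach-zero⁻ () | no _

  reach-zero⇒∈ : ∀ {Z u l} → u ∈ₗ Z → reach G 0 u l ≡ true → l ∈ₗ Z
  reach-zero⇒∈ {u = u} {l} u∈Z r with reach-zero⁻ {u} {l} r
  ... | refl = u∈Z

  reach-suc⁻ : ∀ k {u l} → reach G (suc k) u l ≡ true →
    reach G k u l ≡ true ⊎ ∃[ w ] u ~ w × reach G k w l ≡ true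
  reach-suc⁻ k {u} {l} r with reach G k u l
  ... | true  = inj₁ refl
  ... | false with satisfied (any⁻ _ (allFin n) (from T-≡ r))
  ...   | w , u~w∧r′ with to T-∧ u~w∧r′
  ...     | u~w , r′ = inj₂ (w , to T-≡ u~w , to T-≡ r′)

  reach-suc⁺ˡ : ∀ k {u l} → reach G k u l ≡ true → reach G (suc k) u l ≡ true
  reach-suc⁺ˡ k r rewrite r = refl

  reach-suc⁺ʳ : ∀ k {u w l} → u ~ w → reach G k w l ≡ true → reach G (suc k) u l ≡ true
  reach-suc⁺ʳ k {u} {w} {l} u~w r = trans
    (cong (reach G k u l ∨_) (to T-≡ (any⁺ _ (lose (∈-allFin w) (from T-∧ (from T-≡ u~w , from T-≡ r))))))
    (∨-zeroʳ _)

  module _ {X v l} (exits : ExitsOnlyThrough X v) (l∉X : l ∉ₗ X) where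

    reach-through-exit : ∀ k {u} → u ∈ₗ X → reach G (suc k) u l ≡ true → reach G k v l ≡ true
    reach-inside⇒reach-exit : ∀ k {u} → u ∈ₗ X → reach G k u l ≡ true → reach G k v l ≡ true

    reach-through-exit k u∈X r with reach-suc⁻ k r
    ... | inj₁ r′ = reach-inside⇒reach-exit k u∈X r′
    ... | inj₂ (w , u~w , r′) with exits u∈X u~w
    ...   | inj₁ w∈X = reach-inside⇒reach-exit k w∈X r′
    ...   | inj₂ refl = r′

    reach-inside⇒reach-exit zero u∈X r = ⊥-elim (l∉X (reach-zero⇒∈ u∈X r))
    reach-inside⇒reach-exit (suc k) u∈X r = reach-suc⁺ˡ k (reach-through-exit k u∈X r)

  reach-neighbours-of-cut-vertex : ∀ {v X Y a b l} → ExitsOnlyThrough X v → ExitsOnlyThrough Y v →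
    a ∈ₗ X → b ∈ₗ Y → v ~ a → v ~ b → l ∉ₗ X → l ∉ₗ Y → ∀ k → reach G k a l ≡ reach G k b l
  reach-neighbours-of-cut-vertex exitsX exitsY a∈X b∈Y v~a v~b l∉X l∉Y zero =
    ⇔→≡ (mk⇔ (⊥-elim ∘ l∉X ∘ reach-zero⇒∈ a∈X) (⊥-elim ∘ l∉Y ∘ reach-zero⇒∈ b∈Y))
  reach-neighbours-of-cut-vertex exitsX exitsY a∈X b∈Y v~a v~b l∉X l∉Y (suc k) =
    ⇔→≡ (mk⇔ (reach-suc⁺ʳ k (~-sym v~b) ∘ reach-through-exit exitsX l∉X k a∈X)
              (reach-suc⁺ʳ k (~-sym v~a) ∘ reach-through-exit exitsY l∉Y k b∈Y))

  dist-cong-reach : ∀ {a b l} → (∀ k → reach G k a l ≡ reach G k b l) → dist G a l ≡ dist G b l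
  dist-cong-reach {a} {b} {l} reach-eq = distSearch-eq n 0
    where
    distSearch-eq : ∀ fuel k → distSearch G a l k fuel ≡ distSearch G b l k fuel
    distSearch-eq zero       k = refl
    distSearch-eq (suc fuel) k rewrite reach-eq k | distSearch-eq fuel (suc k) = refl

  Leg-heads-equidistant : ∀ {v a as b bs l} → Leg v (a ∷ as) → Leg v (b ∷ bs) →
    l ∉ₗ a ∷ as → l ∉ₗ b ∷ bs → dist G a l ≡ dist G b l
  Leg-heads-equidistant legᵃ legᵇ l∉as l∉bs = dist-cong-reach
    (reach-neighbours-of-cut-vertex (Leg-closed legᵃ) (Leg-closed legᵇ) (here refl) (here refl)
      (Leg-head legᵃ) (Leg-head legᵇ) l∉as l∉bs)

  dominator-of-Leg-vertex : ∀ {v ys u w} → Leg v ys → u ∈ₗ ys → Dominates G w u → w ≡ v ⊎ w ∈ₗ ys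
  dominator-of-Leg-vertex leg u∈ys (inj₁ refl) = inj₂ u∈ys
  dominator-of-Leg-vertex leg u∈ys (inj₂ w~u) with Leg-closed leg u∈ys (~-sym w~u)
  ... | inj₁ w∈ys = inj₂ w∈ys
  ... | inj₂ w≡v  = inj₁ w≡v

  dominated-Leg-vertex⇒watcher-in-star : ∀ {W L v ys u} → BranchingPoint G v → Leg v ys → u ∈ₗ ys →
    DominatedBy G W u → ∃[ w ] InStar v w × (w ∈ W ⊎ w ∈ L)
  dominated-Leg-vertex⇒watcher-in-star bv leg u∈ys (w , w∈W , w-dominates) =
    w , (bv , map₂ (λ w∈ys → _ , leg , w∈ys) (dominator-of-Leg-vertex leg u∈ys w-dominates)) , inj₁ w∈W

  two-Legs⇒detector-in-star : ∀ {W L v ys ys′} → IsDetectionPair G W L → BranchingPoint G v →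
    Leg v ys → Leg v ys′ → ys ≢ ys′ → ∃[ w ] InStar v w × (w ∈ W ⊎ w ∈ L)
  two-Legs⇒detector-in-star {ys = a ∷ as} {b ∷ bs} dp bv legᵃ legᵇ ys≢ys′ with dp a
  ... | inj₁ a-dominated = dominated-Leg-vertex⇒watcher-in-star bv legᵃ (here refl) a-dominated
  ... | inj₂ a-separated with a-separated b (λ { refl → ys≢ys′ (cong (a ∷_) (Leg-determined-by-head legᵃ legᵇ)) })
  ...   | inj₁ b-dominated = dominated-Leg-vertex⇒watcher-in-star bv legᵇ (here refl) b-dominated
  ...   | inj₂ (l , l∈L , l-separates) with l ∈ₗ? a ∷ as | l ∈ₗ? b ∷ bs
  ...     | yes l∈as | _        = l , (bv , inj₂ (_ , legᵃ , l∈as)) , inj₂ l∈L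
  ...     | no _     | yes l∈bs = l , (bv , inj₂ (_ , legᵇ , l∈bs)) , inj₂ l∈L
  ...     | no l∉as  | no l∉bs  = ⊥-elim (l-separates (Leg-heads-equidistant legᵃ legᵇ l∉as l∉bs))

  B2+⇒detector-in-star : ∀ {W L v} → IsDetectionPair G W L → InB2+ G v →
    ∃[ w ] InStar v w × (w ∈ W ⊎ w ∈ L)
  B2+⇒detector-in-star dp ((bv , _) , qs , _ , qs′ , _ , isLeg , isLeg′ , legs≢) =
    two-Legs⇒detector-in-star dp bv (isLeg⇒Leg qs isLeg) (isLeg⇒Leg qs′ isLeg′) legs≢

mainTheorem4 : (G : Graph) → (B W L : Subset (Graph.n G)) →
    (∀ v → v ∈ B → InB2+ G v) → IsDetectionPair G W L → ∣ B ∣ ≤ ∣ W ∣ + ∣ L ∣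
mainTheorem4 G B W L B⊆B2+ dp =
  ∣B∣≤∣W∣+∣L∣-by-matching (InStar G) (InStar-injective G) B W L
    (λ {b} b∈B → B2+⇒detector-in-star G dp (B⊆B2+ b b∈B))
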